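{- Let $d$ and $r$ be positive integers with $r > 1$, and let $G = K_2 \times K_{(d+1)r}$. Then $\chi(G) = 2$ and $\chi_d^=(G) = r$.
   Context: All graphs are finite, simple and undirected. The categorical (tensor) product $G\times H$ has vertex set $V(G)\times V(H)$, with $(u_1,v_1)(u_2,v_2)$ an edge iff $u_1u_2\in E(G)$ and $v_1v_2\in E(H)$. $\chi$ is the chromatic number. An exact $(k,d)$-coloring of $G=(V,E)$ is a map $c: V\to\{1,\dots,k\}$ such that every vertex has exactly $d$ neighbors of its own color; $\chi_d^=(G)$ is the least $k$ for which one exists ($\infty$ if none). -}

module Defs where

open import Data.Nat using (ℕ; _*_; _<_)
open import Data.Fin using (Fin; remQuot)
import Data.Fin as Fin
open import Data.Bool using (Bool; true; false; _∧_; not)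
open import Data.List using (List; length; filterᵇ)
open import Data.Fin.Properties using (_≟_)
open import Data.List using () renaming (allFin to allFinL)
open import Data.Product using (Σ; proj₁; proj₂)
open import Relation.Nullary using (¬_; does)
open import Relation.Binary.PropositionalEquality using (_≡_; refl; cong₂)

record Graph : Set where
  field
    size   : ℕ
    adj    : Fin size → Fin size → Bool
    sym    : ∀ u v → adj u v ≡ adj v u
    irrefl : ∀ v → adj v v ≡ false
open Graph public

K : ℕ → Graph
K n = record
  { size = n
  ; adj = λ u v → not (does (u ≟ v))
  ; sym = symK
  ; irrefl = irrK }
  where
  symK : ∀ u v → not (does (u ≟ v)) ≡ not (does (v ≟ u))
  symK u v with u ≟ v | v ≟ u
  ... | Relation.Nullary.yes _ | Relation.Nullary.yes _ = refl
  ... | Relation.Nullary.no _  | Relation.Nullary.no _  = refl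
  ... | Relation.Nullary.yes p | Relation.Nullary.no q  = Data.Empty.⊥-elim (q (Relation.Binary.PropositionalEquality.sym p))
    where import Data.Empty
  ... | Relation.Nullary.no p  | Relation.Nullary.yes q = Data.Empty.⊥-elim (p (Relation.Binary.PropositionalEquality.sym q))
    where import Data.Empty
  irrK : ∀ v → not (does (v ≟ v)) ≡ false
  irrK v with v ≟ v
  ... | Relation.Nullary.yes _ = refl
  ... | Relation.Nullary.no q = Data.Empty.⊥-elim (q refl)
    where import Data.Empty

-- Categorical (tensor) product G × H; the vertex set Fin (|G| * |H|)
-- is identified with Fin |G| × Fin |H| via the bijection remQuot.
_×ᵍ_ : Graph → Graph → Graph
G ×ᵍ H = record
  { size = size G * size H
  ; adj = λ x y → adj G (π₁ x) (π₁ y) ∧ adj H (π₂ x) (π₂ y)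
  ; sym = λ x y → cong₂ _∧_ (sym G (π₁ x) (π₁ y)) (sym H (π₂ x) (π₂ y))
  ; irrefl = irr }
  where
  π₁ : Fin (size G * size H) → Fin (size G)
  π₁ x = proj₁ (remQuot {size G} (size H) x)
  π₂ : Fin (size G * size H) → Fin (size H)
  π₂ x = proj₂ (remQuot {size G} (size H) x)
  irr : ∀ x → adj G (π₁ x) (π₁ x) ∧ adj H (π₂ x) (π₂ x) ≡ false
  irr x rewrite irrefl G (π₁ x) = refl

Coloring : Graph → ℕ → Set
Coloring G k = Fin (size G) → Fin k

Proper : (G : Graph) {k : ℕ} → Coloring G k → Set
Proper G c = ∀ u v → adj G u v ≡ true → ¬ (c u ≡ c v)

Colorable : Graph → ℕ → Set
Colorable G k = Σ (Coloring G k) (Proper G)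

ChromaticNumberIs : Graph → ℕ → Set
ChromaticNumberIs G k = Colorable G k Data.Product.× (∀ j → j < k → ¬ Colorable G j)
  where import Data.Product

sameColorNbrs : (G : Graph) {k : ℕ} → Coloring G k → Fin (size G) → ℕ
sameColorNbrs G c v =
  length (filterᵇ (λ w → adj G v w ∧ does (c w ≟ c v)) (allFinL (size G)))

ExactColoring : (G : Graph) (k d : ℕ) → Coloring G k → Set
ExactColoring G k d c = ∀ v → sameColorNbrs G c v ≡ d

ExactColorable : Graph → ℕ → ℕ → Set
ExactColorable G k d = Σ (Coloring G k) (ExactColoring G k d)

ExactChromaticNumberIs : Graph → ℕ → ℕ → Set
ExactChromaticNumberIs G d k =
  ExactColorable G k d Data.Product.× (∀ j → j < k → ¬ ExactColorable G j d)
  where import Data.Product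

{-# OPTIONS --safe #-}
module Submission where

-- χ = 2: the projection to K₂ is a proper colouring, and K₂ × K_N has edges.
-- Upper bound: split K_{(d+1)r} into r blocks of size d+1 and colour (i, a) by the
-- block of a; then (i, a) sees exactly the d other members of its block, on the
-- opposite side. Lower bound: with j < r colours some colour class on one side has
-- at least d+2 members (pigeonhole). A vertex v of that class has a neighbour w of
-- the same colour (d > 0), and w is adjacent to every member of the class except
-- possibly one, so w has at least d+1 neighbours of its colour.

open import Defs hiding (sym)
open import Data.Bool using (Bool; true; false; _∧_; not)
open import Data.Bool.Properties using (∧-assoc)
open import Data.Fin using (Fin; zero; suc; _↑ˡ_; _↑ʳ_; combine; remQuot)
open import Data.Fin.Properties using (_≟_; ¬Fin0; any?; remQuot-combine)
open import Data.List using (length; filterᵇ; tabulate)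
open import Data.Nat using (ℕ; zero; suc; _+_; _*_; _≤_; _<_; _<?_; z≤n; s≤s)
open import Data.Nat.Properties
  using ( +-*-semiring; +-assoc; +-comm; +-identityʳ; *-identityˡ; *-comm; suc-injective
        ; ≤-refl; ≤-trans; <-≤-trans; <⇒≱; ≮⇒≥; m≤m+n; m≤n+m; m≤m*n
        ; +-mono-≤; +-monoˡ-≤; *-monoˡ-<; module ≤-Reasoning )
open import Algebra.Properties.Semiring.Sum +-*-semiring
  using (sum; sum-syntax; sum-cong-≗; ∑-comm; ∑-distrib-+; *-distribʳ-sum)
open import Data.Empty using (⊥-elim)
open import Data.Product using (∃-syntax; _×_; _,_; proj₁; proj₂)
open import Function using (_∘_; id)
open import Relation.Binary.PropositionalEquality
open import Relation.Nullary using (Dec; yes; no; does; ¬_)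
open import Relation.Nullary.Decidable using (dec-true)

does-true⇒ : ∀ {p} {A : Set p} (a? : Dec A) → does a? ≡ true → A
does-true⇒ (yes a) _  = a
does-true⇒ (no _)  ()

not-does-true⇒ : ∀ {p} {A : Set p} (a? : Dec A) → not (does a?) ≡ true → ¬ A
not-does-true⇒ (yes _) ()
not-does-true⇒ (no ¬a) _ = ¬a

∧≡true : ∀ {a b} → a ∧ b ≡ true → a ≡ true × b ≡ true
∧≡true {true} {true} _ = refl , refl

indicator : Bool → ℕ
indicator true  = 1
indicator false = 0

count : ∀ {m} → (Fin m → Bool) → ℕ
count {m} p = ∑[ x < m ] indicator (p x)

length-filterᵇ-tabulate : ∀ {A : Set} m (p : A → Bool) (f : Fin m → A) →
  length (filterᵇ p (tabulate f)) ≡ count (p ∘ f)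
length-filterᵇ-tabulate zero    p f = refl
length-filterᵇ-tabulate (suc m) p f with p (f zero)
... | true  = cong suc (length-filterᵇ-tabulate m p (f ∘ suc))
... | false = length-filterᵇ-tabulate m p (f ∘ suc)

count-cong : ∀ {m} {p q : Fin m → Bool} → (∀ x → p x ≡ q x) → count p ≡ count q
count-cong p≗q = sum-cong-≗ (cong indicator ∘ p≗q)

count-false : ∀ m → count {m} (λ _ → false) ≡ 0
count-false zero    = refl
count-false (suc m) = count-false m

count-true : ∀ m → count {m} (λ _ → true) ≡ m
count-true zero    = refl
count-true (suc m) = cong suc (count-true m)

count-≟ˡ : ∀ {m} (x₀ : Fin m) → count (λ x → does (x₀ ≟ x)) ≡ 1
count-≟ˡ {suc m} zero    = cong suc (count-false m)
count-≟ˡ         (suc x₀) = count-≟ˡ x₀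

count-≟ʳ : ∀ {m} (x₀ : Fin m) → count (λ x → does (x ≟ x₀)) ≡ 1
count-≟ʳ {suc m} zero    = cong suc (count-false m)
count-≟ʳ         (suc x₀) = count-≟ʳ x₀

indicator-mono : ∀ {a b} → (a ≡ true → b ≡ true) → indicator a ≤ indicator b
indicator-mono {true}  a⇒b rewrite a⇒b refl = ≤-refl
indicator-mono {false} a⇒b = z≤n

sum-mono : ∀ {m} {f g : Fin m → ℕ} → (∀ x → f x ≤ g x) → sum f ≤ sum g
sum-mono {zero}  f≤g = z≤n
sum-mono {suc m} f≤g = +-mono-≤ (f≤g zero) (sum-mono (f≤g ∘ suc))

count-mono : ∀ {m} {p q : Fin m → Bool} → (∀ x → p x ≡ true → q x ≡ true) → count p ≤ count q
count-mono p⇒q = sum-mono (λ x → indicator-mono (p⇒q x))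

count-split : ∀ {m} (q p : Fin m → Bool) →
  count p ≡ count (λ x → q x ∧ p x) + count (λ x → not (q x) ∧ p x)
count-split q p =
  trans (sum-cong-≗ (λ x → split (q x) (p x)))
        (∑-distrib-+ (λ x → indicator (q x ∧ p x)) (λ x → indicator (not (q x) ∧ p x)))
  where
  split : ∀ a b → indicator b ≡ indicator (a ∧ b) + indicator (not a ∧ b)
  split true  b = sym (+-identityʳ _)
  split false b = refl

count-∧ˡ : ∀ {m} a (p : Fin m → Bool) → count (λ x → a ∧ p x) ≡ indicator a * count p
count-∧ˡ     true  p = sym (+-identityʳ (count p))
count-∧ˡ {m} false p = count-false m

count≤1+count-≢ : ∀ {m} (x₀ : Fin m) p → count p ≤ suc (count (λ x → not (does (x₀ ≟ x)) ∧ p x))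
count≤1+count-≢ x₀ p = begin
  count p                                     ≡⟨ count-split (λ x → does (x₀ ≟ x)) p ⟩
  count (λ x → does (x₀ ≟ x) ∧ p x) + others  ≤⟨ +-monoˡ-≤ others (count-mono drop-p) ⟩
  count (λ x → does (x₀ ≟ x)) + others        ≡⟨ cong (_+ others) (count-≟ˡ x₀) ⟩
  suc others                                  ∎
  where
  open ≤-Reasoning
  others = count (λ x → not (does (x₀ ≟ x)) ∧ p x)
  drop-p : ∀ x → does (x₀ ≟ x) ∧ p x ≡ true → does (x₀ ≟ x) ≡ true
  drop-p x = proj₁ ∘ ∧≡true

count>0⇒∃ : ∀ {m} (p : Fin m → Bool) → 0 < count p → ∃[ x ] p x ≡ true
count>0⇒∃ {suc m} p pos with p zero in eq
... | true  = zero , eq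
... | false with count>0⇒∃ (p ∘ suc) pos
...   | x , px = suc x , px

≤-sum : ∀ {m} (f : Fin m → ℕ) x → f x ≤ sum f
≤-sum f zero    = m≤m+n _ _
≤-sum f (suc x) = ≤-trans (≤-sum (f ∘ suc) x) (m≤n+m _ _)

sum-≤-* : ∀ {m} {f : Fin m → ℕ} B → (∀ x → f x ≤ B) → sum f ≤ m * B
sum-≤-* {zero}  B f≤B = z≤n
sum-≤-* {suc m} B f≤B = +-mono-≤ (f≤B zero) (sum-≤-* B (f≤B ∘ suc))

∑-↑ : ∀ m {n} (f : Fin (m + n) → ℕ) → sum f ≡ sum (f ∘ (_↑ˡ n)) + sum (f ∘ (m ↑ʳ_))
∑-↑ zero    f = refl
∑-↑ (suc m) f = trans (cong (f zero +_) (∑-↑ m (f ∘ suc))) (sym (+-assoc (f zero) _ _))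

∑-combine : ∀ m {n} (f : Fin (m * n) → ℕ) → sum f ≡ ∑[ i < m ] ∑[ j < n ] f (combine i j)
∑-combine zero    f = refl
∑-combine (suc m) {n} f =
  trans (∑-↑ n f) (cong (sum (f ∘ (_↑ˡ (m * n))) +_) (∑-combine m (f ∘ (n ↑ʳ_))))

∑-fibres : ∀ {m j} (f : Fin m → Fin j) → ∑[ k < j ] count (λ a → does (f a ≟ k)) ≡ m
∑-fibres {m} f = begin
  ∑[ k < _ ] ∑[ a < m ] indicator (does (f a ≟ k)) ≡⟨ ∑-comm (λ k a → indicator (does (f a ≟ k))) ⟩
  ∑[ a < m ] count (λ k → does (f a ≟ k))           ≡⟨ sum-cong-≗ (count-≟ˡ ∘ f) ⟩
  count {m} (λ _ → true)                            ≡⟨ count-true m ⟩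
  m                                                 ∎
  where open ≡-Reasoning

∃-above-average : ∀ {j} (g : Fin j → ℕ) B → j * B < sum g → ∃[ k ] B < g k
∃-above-average g B j*B<∑g with any? (λ k → B <? g k)
... | yes large = large
... | no ¬large = ⊥-elim (<⇒≱ j*B<∑g (sum-≤-* B (λ k → ≮⇒≥ (λ B<gk → ¬large (k , B<gk)))))

pigeonhole : ∀ {m j} (f : Fin m → Fin j) B → j * B < m → ∃[ k ] B < count (λ a → does (f a ≟ k))
pigeonhole f B j*B<m = ∃-above-average _ B (subst (_ <_) (sym (∑-fibres f)) j*B<m)

degree : (G : Graph) → Fin (size G) → ℕ
degree G v = count (adj G v)

sameColorNbrs≡count : ∀ G {k} (c : Coloring G k) v →
  sameColorNbrs G c v ≡ count (λ w → adj G v w ∧ does (c w ≟ c v))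
sameColorNbrs≡count G c v = length-filterᵇ-tabulate (size G) _ id

∃-sameColorNbr : ∀ G {k} (c : Coloring G k) v → 0 < sameColorNbrs G c v →
  ∃[ w ] adj G v w ≡ true × c w ≡ c v
∃-sameColorNbr G c v pos
  with w , vw∧cw≡cv ← count>0⇒∃ _ (subst (0 <_) (sameColorNbrs≡count G c v) pos)
  with vw , cw≡cv ← ∧≡true vw∧cw≡cv
  = w , vw , does-true⇒ (c w ≟ c v) cw≡cv

module Product (G H : Graph) where

  ⟨_,_⟩ : Fin (size G) → Fin (size H) → Fin (size (G ×ᵍ H))
  ⟨ i , b ⟩ = combine i b

  π₁ : Fin (size (G ×ᵍ H)) → Fin (size G)
  π₁ x = proj₁ (remQuot {size G} (size H) x)

  π₂ : Fin (size (G ×ᵍ H)) → Fin (size H)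
  π₂ x = proj₂ (remQuot {size G} (size H) x)

  π₁-combine : ∀ i b → π₁ ⟨ i , b ⟩ ≡ i
  π₁-combine i b = cong proj₁ (remQuot-combine i b)

  π₂-combine : ∀ i b → π₂ ⟨ i , b ⟩ ≡ b
  π₂-combine i b = cong proj₂ (remQuot-combine i b)

  adj-combine : ∀ x i b → adj (G ×ᵍ H) x ⟨ i , b ⟩ ≡ adj G (π₁ x) i ∧ adj H (π₂ x) b
  adj-combine x i b =
    cong₂ (λ i′ b′ → adj G (π₁ x) i′ ∧ adj H (π₂ x) b′) (π₁-combine i b) (π₂-combine i b)

  adj⇒adj₁ : ∀ {x y} → adj (G ×ᵍ H) x y ≡ true → adj G (π₁ x) (π₁ y) ≡ true
  adj⇒adj₁ xy = proj₁ (∧≡true xy)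

  proper-lift : ∀ {k} {c : Coloring G k} → Proper G c → Proper (G ×ᵍ H) (c ∘ π₁)
  proper-lift proper x y xy = proper (π₁ x) (π₁ y) (adj⇒adj₁ xy)

  sameColorNbrs-fibres : ∀ {k} (c : Coloring (G ×ᵍ H) k) x → sameColorNbrs (G ×ᵍ H) c x ≡
    ∑[ i < size G ] count (λ b → adj (G ×ᵍ H) x ⟨ i , b ⟩ ∧ does (c ⟨ i , b ⟩ ≟ c x))
  sameColorNbrs-fibres c x = trans (sameColorNbrs≡count (G ×ᵍ H) c x)
    (∑-combine (size G) (λ y → indicator (adj (G ×ᵍ H) x y ∧ does (c y ≟ c x))))

  sameColorNbrs-lift : ∀ {k} (c : Coloring H k) x →
    sameColorNbrs (G ×ᵍ H) (c ∘ π₂) x ≡ degree G (π₁ x) * sameColorNbrs H c (π₂ x)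
  sameColorNbrs-lift c x = begin
    sameColorNbrs (G ×ᵍ H) (c ∘ π₂) x
      ≡⟨ sameColorNbrs-fibres (c ∘ π₂) x ⟩
    ∑[ i < size G ] count (λ b → adj (G ×ᵍ H) x ⟨ i , b ⟩ ∧ does (c (π₂ ⟨ i , b ⟩) ≟ c y))
      ≡⟨ sum-cong-≗ (λ i → count-cong (fibre i)) ⟩
    ∑[ i < size G ] count (λ b → adj G (π₁ x) i ∧ sameColor b)
      ≡⟨ sum-cong-≗ (λ i → count-∧ˡ (adj G (π₁ x) i) sameColor) ⟩
    ∑[ i < size G ] (indicator (adj G (π₁ x) i) * count sameColor)
      ≡⟨ *-distribʳ-sum (count sameColor) (indicator ∘ adj G (π₁ x)) ⟨
    degree G (π₁ x) * count sameColor
      ≡⟨ cong (degree G (π₁ x) *_) (sameColorNbrs≡count H c y) ⟨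
    degree G (π₁ x) * sameColorNbrs H c y ∎
    where
    open ≡-Reasoning
    y = π₂ x
    sameColor : Fin (size H) → Bool
    sameColor b = adj H y b ∧ does (c b ≟ c y)
    fibre : ∀ i b → adj (G ×ᵍ H) x ⟨ i , b ⟩ ∧ does (c (π₂ ⟨ i , b ⟩) ≟ c y)
                  ≡ adj G (π₁ x) i ∧ sameColor b
    fibre i b = trans (cong₂ (λ e b′ → e ∧ does (c b′ ≟ c y)) (adj-combine x i b) (π₂-combine i b))
                      (∧-assoc (adj G (π₁ x) i) (adj H y b) _)

  sameColorNbrs-fibre≤ : ∀ {k} (c : Coloring (G ×ᵍ H) k) w {i} → adj G (π₁ w) i ≡ true →
    count (λ b → adj H (π₂ w) b ∧ does (c ⟨ i , b ⟩ ≟ c w)) ≤ sameColorNbrs (G ×ᵍ H) c w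
  sameColorNbrs-fibre≤ c w {i} wi = begin
    count (λ b → adj H (π₂ w) b ∧ sameColor i b)
      ≡⟨ count-cong (λ b → cong (_∧ sameColor i b) (adj-fibre b)) ⟨
    count (λ b → adj (G ×ᵍ H) w ⟨ i , b ⟩ ∧ sameColor i b)
      ≤⟨ ≤-sum (λ i′ → count (λ b → adj (G ×ᵍ H) w ⟨ i′ , b ⟩ ∧ sameColor i′ b)) i ⟩
    ∑[ i′ < size G ] count (λ b → adj (G ×ᵍ H) w ⟨ i′ , b ⟩ ∧ sameColor i′ b)
      ≡⟨ sameColorNbrs-fibres c w ⟨
    sameColorNbrs (G ×ᵍ H) c w ∎
    where
    open ≤-Reasoning
    sameColor : Fin (size G) → Fin (size H) → Bool
    sameColor i′ b = does (c ⟨ i′ , b ⟩ ≟ c w)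
    adj-fibre : ∀ b → adj (G ×ᵍ H) w ⟨ i , b ⟩ ≡ adj H (π₂ w) b
    adj-fibre b = trans (adj-combine w i b) (cong (_∧ adj H (π₂ w) b) wi)

degree-K2 : ∀ v → degree (K 2) v ≡ 1
degree-K2 zero       = refl
degree-K2 (suc zero) = refl

proper-K : ∀ n → Proper (K n) id
proper-K n u v uv = not-does-true⇒ (u ≟ v) uv

sameColorNbrs-K : ∀ {n k} (c : Coloring (K n) k) a →
  suc (sameColorNbrs (K n) c a) ≡ count (λ b → does (c b ≟ c a))
sameColorNbrs-K {n} c a = sym (begin
  count (λ b → does (c b ≟ c a))
    ≡⟨ count-split (λ b → does (a ≟ b)) _ ⟩
  count (λ b → does (a ≟ b) ∧ does (c b ≟ c a))
    + count (λ b → not (does (a ≟ b)) ∧ does (c b ≟ c a))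
    ≡⟨ cong₂ _+_ (trans (count-cong self) (count-≟ˡ a)) (sym (sameColorNbrs≡count (K n) c a)) ⟩
  suc (sameColorNbrs (K n) c a) ∎)
  where
  open ≡-Reasoning
  self : ∀ b → does (a ≟ b) ∧ does (c b ≟ c a) ≡ does (a ≟ b)
  self b with a ≟ b
  ... | yes refl = dec-true (c a ≟ c a) refl
  ... | no _     = refl

residue : ∀ m {n} → Fin (m * n) → Fin n
residue m {n} x = proj₂ (remQuot {m} n x)

count-residue : ∀ m {n} (s : Fin n) → count (λ x → does (residue m x ≟ s)) ≡ m
count-residue m {n} s = begin
  count (λ x → does (residue m x ≟ s))
    ≡⟨ ∑-combine m (λ x → indicator (does (residue m x ≟ s))) ⟩
  ∑[ q < m ] count {n} (λ s′ → does (residue m (combine q s′) ≟ s))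
    ≡⟨ sum-cong-≗ {m} (λ q → trans (count-cong (residue-combine q)) (count-≟ʳ s)) ⟩
  count {m} (λ _ → true)
    ≡⟨ count-true m ⟩
  m ∎
  where
  open ≡-Reasoning
  residue-combine : ∀ q s′ → does (residue m (combine q s′) ≟ s) ≡ does (s′ ≟ s)
  residue-combine q s′ = cong (λ t → does (proj₂ t ≟ s)) (remQuot-combine q s′)

residue-exact : ∀ d r → ExactColoring (K ((d + 1) * r)) r d (residue (d + 1))
residue-exact d r a = suc-injective (begin
  suc (sameColorNbrs (K ((d + 1) * r)) (residue (d + 1)) a)
    ≡⟨ sameColorNbrs-K (residue (d + 1)) a ⟩
  count (λ b → does (residue (d + 1) b ≟ residue (d + 1) a))
    ≡⟨ count-residue (d + 1) (residue (d + 1) a) ⟩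
  d + 1
    ≡⟨ +-comm d 1 ⟩
  suc d ∎)
  where open ≡-Reasoning

chromaticNumber≡2 : ∀ G → Colorable G 2 → ∀ u v → adj G u v ≡ true → ChromaticNumberIs G 2
chromaticNumber≡2 G colorable u v uv = colorable , fewer
  where
  Fin1-unique : (x y : Fin 1) → x ≡ y
  Fin1-unique zero zero = refl
  fewer : ∀ j → j < 2 → ¬ Colorable G j
  fewer zero          _ (c , _)      = ¬Fin0 (c u)
  fewer (suc zero)    _ (c , proper) = proper u v uv (Fin1-unique (c u) (c v))
  fewer (suc (suc _)) (s≤s (s≤s ()))

chromaticNumber-K2×K : ∀ N → 1 < N → ChromaticNumberIs (K 2 ×ᵍ K N) 2
chromaticNumber-K2×K (suc zero) (s≤s ())
chromaticNumber-K2×K (suc (suc n)) _ =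
  chromaticNumber≡2 (K 2 ×ᵍ K (suc (suc n))) (π₁ , proper-lift (proper-K 2))
    ⟨ zero , zero ⟩ ⟨ suc zero , suc zero ⟩ (adj-combine ⟨ zero , zero ⟩ (suc zero) (suc zero))
  where open Product (K 2) (K (suc (suc n)))

exactColoring-K2× : ∀ H {k d} (c : Coloring H k) →
  ExactColoring H k d c → ExactColoring (K 2 ×ᵍ H) k d (c ∘ Product.π₂ (K 2) H)
exactColoring-K2× H {d = d} c exact x = begin
  sameColorNbrs (K 2 ×ᵍ H) (c ∘ π₂) x       ≡⟨ sameColorNbrs-lift c x ⟩
  degree (K 2) (π₁ x) * sameColorNbrs H c (π₂ x) ≡⟨ cong₂ _*_ (degree-K2 (π₁ x)) (exact (π₂ x)) ⟩
  1 * d                                      ≡⟨ *-identityˡ d ⟩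
  d                                          ∎
  where
  open ≡-Reasoning
  open Product (K 2) H

exactColoring-bound : ∀ G N (i₀ : Fin (size G)) {j d} → 0 < d →
  (c : Coloring (G ×ᵍ K N) j) → ExactColoring (G ×ᵍ K N) j d c → N ≤ j * suc d
exactColoring-bound G N i₀ {j} {d} 0<d c exact = ≮⇒≥ crowdedClass
  where
  open Product G (K N)
  crowdedClass : ¬ j * suc d < N
  crowdedClass j*d′<N
    with k , d′<class ← pigeonhole (λ a → c ⟨ i₀ , a ⟩) (suc d) j*d′<N
    with a , ca≟k ← count>0⇒∃ (λ a → does (c ⟨ i₀ , a ⟩ ≟ k)) (≤-trans (s≤s z≤n) d′<class)
    with w , vw , cw≡cv ← ∃-sameColorNbr (G ×ᵍ K N) c ⟨ i₀ , a ⟩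
                             (subst (0 <_) (sym (exact ⟨ i₀ , a ⟩)) 0<d)
    = <⇒≱ d′<class (begin
      count (λ b → does (c ⟨ i₀ , b ⟩ ≟ k))
        ≡⟨ count-cong (λ b → cong (λ k′ → does (c ⟨ i₀ , b ⟩ ≟ k′)) cw≡k) ⟨
      count (λ b → does (c ⟨ i₀ , b ⟩ ≟ c w))
        ≤⟨ count≤1+count-≢ (π₂ w) _ ⟩
      suc (count (λ b → not (does (π₂ w ≟ b)) ∧ does (c ⟨ i₀ , b ⟩ ≟ c w)))
        ≤⟨ s≤s (sameColorNbrs-fibre≤ c w wi₀) ⟩
      suc (sameColorNbrs (G ×ᵍ K N) c w)
        ≡⟨ cong suc (exact w) ⟩
      suc d ∎)
    where
    open ≤-Reasoning
    cw≡k : c w ≡ k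
    cw≡k = trans cw≡cv (does-true⇒ (c ⟨ i₀ , a ⟩ ≟ k) ca≟k)
    wi₀ : adj G (π₁ w) i₀ ≡ true
    wi₀ = trans (Graph.sym G (π₁ w) i₀)
                (subst (λ i → adj G i (π₁ w) ≡ true) (π₁-combine i₀ a) (adj⇒adj₁ vw))

mainTheorem20 : (d r : ℕ) → 0 < d → 1 < r →
    ChromaticNumberIs (K 2 ×ᵍ K ((d + 1) * r)) 2
      × ExactChromaticNumberIs (K 2 ×ᵍ K ((d + 1) * r)) d r
mainTheorem20 d r 0<d 1<r =
    chromaticNumber-K2×K N (<-≤-trans 1<r r≤N)
  , (residue (d + 1) ∘ π₂ , exactColoring-K2× (K N) (residue (d + 1)) (residue-exact d r))
  , tooFew
  where
  N = (d + 1) * r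
  open Product (K 2) (K N)
  N≡r*d′ : N ≡ r * suc d
  N≡r*d′ = trans (cong (_* r) (+-comm d 1)) (*-comm (suc d) r)
  r≤N : r ≤ N
  r≤N = subst (r ≤_) (sym N≡r*d′) (m≤m*n r (suc d))
  tooFew : ∀ j → j < r → ¬ ExactColorable (K 2 ×ᵍ K N) j d
  tooFew j j<r (c , exactⱼ) =
    <⇒≱ (subst (j * suc d <_) (sym N≡r*d′) (*-monoˡ-< (suc d) j<r))
        (exactColoring-bound (K 2) N zero 0<d c exactⱼ)
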